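{- Let $\psi:\mathbb Z^r\times\mathbb Z^r\to\mu_\infty$ be a bicharacter, $E=(e_1,\dots,e_r)$ a basis of $\mathbb Z^r$, and $\zeta$ a root of unity of even order $n$ such that every value of $\psi$ is a power of $\zeta$. Fix $i$, assume $E$ is admissible at $i$ and that $\psi(e_i,a)\psi(a,e_i)$ is a power of $\psi(e_i,e_i)$ for all $a\in\mathbb Z^r$. Then: (1) for all $j\ne i$, $m_{ij}$ is the least nonnegative integer $m$ with $\psi(e_i,e_i)^m\psi(e_i,e_j)\psi(e_j,e_i)=1$; in particular $m_{ij}=n_{ij}$, where $n_{ij}$ is the least nonnegative integer with $n_{ij}(M_{ii}+\frac n2)\equiv-M_{ij}\bmod n$ for $M=M^{\psi,E,\zeta}$; (2) $M^{\psi,s_{i,E}(E),\zeta}=M^{\psi,E,\zeta}$.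
   Context: $\psi$ is multiplicative in each variable. $E$ is admissible at $i$ if $\psi(e_i,e_i)\ne1$. For $j\ne i$, $m_{ij}=\min\{m\ge0:\psi(e_i,e_i)^{m+1}=1\text{ or }\psi(e_i,e_i)^m\psi(e_i,e_j)\psi(e_j,e_i)=1\}$; $s_{i,E}$ is the linear map with $s_{i,E}(e_i)=-e_i$, $s_{i,E}(e_j)=e_j+m_{ij}e_i$, and $s_{i,E}(E)=(s_{i,E}(e_1),\dots,s_{i,E}(e_r))$. For a basis $E'=(e'_1,\dots,e'_r)$, $M^{\psi,E',\zeta}$ is the $r\times r$ matrix with $M_{jk}$ the least nonnegative $m$ with $\zeta^m=\psi(e'_j,e'_k)\psi(e'_k,e'_j)$ if $j\ne k$ and $\zeta^m=-\psi(e'_j,e'_j)$ if $j=k$. -}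

module Defs where

open import Level using (Level; _⊔_)
open import Data.Nat using (ℕ; zero; suc; _<_)
open import Data.Integer as ℤ using (ℤ)
open import Data.Fin using (Fin; zero; suc)
open import Data.Vec using (Vec; zipWith; map; replicate)
open import Data.Product using (_×_; ∃)
open import Data.Sum using (_⊎_)
open import Relation.Nullary using (¬_)
open import Relation.Binary.PropositionalEquality using (_≡_; _≢_)
open import Algebra.Bundles using (AbelianGroup)

Least : ∀ {p} → (ℕ → Set p) → ℕ → Set p
Least P m = P m × (∀ k → k < m → ¬ P k)

_+v_ : ∀ {r} → Vec ℤ r → Vec ℤ r → Vec ℤ r
_+v_ = zipWith ℤ._+_

_·v_ : ∀ {r} → ℤ → Vec ℤ r → Vec ℤ r
k ·v a = map (k ℤ.*_) a

negv : ∀ {r} → Vec ℤ r → Vec ℤ r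
negv a = map ℤ.-_ a

0v : ∀ {r} → Vec ℤ r
0v {r} = replicate r (ℤ.+ 0)

lin : ∀ {r m} → (Fin m → ℤ) → (Fin m → Vec ℤ r) → Vec ℤ r
lin {m = zero} c e = 0v
lin {m = suc m} c e = (c zero ·v e zero) +v lin (λ k → c (suc k)) (λ k → e (suc k))

IsBasis : ∀ {r} → (Fin r → Vec ℤ r) → Set
IsBasis E = (∀ a → ∃ λ c → lin c E ≡ a)
          × (∀ c → lin c E ≡ 0v → ∀ k → c k ≡ ℤ.+ 0)

module WithGroup {c ℓ} (G : AbelianGroup c ℓ) where
  open AbelianGroup G

  pow : Carrier → ℕ → Carrier
  pow x zero = ε
  pow x (suc m) = x ∙ pow x m

  IsBicharacter : ∀ {r} → (Vec ℤ r → Vec ℤ r → Carrier) → Set ℓ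
  IsBicharacter ψ = (∀ a b d → ψ (a +v b) d ≈ ψ a d ∙ ψ b d)
                  × (∀ a b d → ψ a (b +v d) ≈ ψ a b ∙ ψ a d)

  module Setup {r : ℕ} (ψ : Vec ℤ r → Vec ℤ r → Carrier) where

    Admissible : (Fin r → Vec ℤ r) → Fin r → Set ℓ
    Admissible E i = ¬ (ψ (E i) (E i) ≈ ε)

    MijProp : (Fin r → Vec ℤ r) → Fin r → Fin r → ℕ → Set ℓ
    MijProp E i j m =
      (pow (ψ (E i) (E i)) (suc m) ≈ ε)
      ⊎ ((pow (ψ (E i) (E i)) m ∙ ψ (E i) (E j)) ∙ ψ (E j) (E i) ≈ ε)

    IsMij : (Fin r → Vec ℤ r) → Fin r → Fin r → ℕ → Set ℓ
    IsMij E i j m = Least (MijProp E i j) m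

    sRefl : (Fin r → Vec ℤ r) → Fin r → (Fin r → ℕ) → Fin r → Vec ℤ r
    sRefl E i mij j with j Data.Fin.≟ i
    ... | Relation.Nullary.yes _ = negv (E i)
    ... | Relation.Nullary.no _ = E j +v ((ℤ.+ (mij j)) ·v E i)

    module WithZeta (ζ : Carrier) (n : ℕ) where
      -- −x in μ_∞, where −1 = ζ^{n/2} for ζ of even order n
      neg : Carrier → Carrier
      neg x = pow ζ (Data.Nat._/_ n 2) ∙ x

      MProp : (Fin r → Vec ℤ r) → Fin r → Fin r → ℕ → Set ℓ
      MProp E' j k m =
        (j ≡ k → pow ζ m ≈ neg (ψ (E' j) (E' j)))
        × (j ≢ k → pow ζ m ≈ ψ (E' j) (E' k) ∙ ψ (E' k) (E' j))

      IsM : (Fin r → Vec ℤ r) → Fin r → Fin r → ℕ → Set ℓ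
      IsM E' j k m = Least (MProp E' j k) m

{-# OPTIONS --safe #-}
module Submission where

-- Write q = ψ(e_i,e_i) and c_j = ψ(e_i,e_j) ψ(e_j,e_i). If q^{m+1} = 1 then, c_j being a power of q,
-- c_j⁻¹ is already some q^t with t ≤ m; so the minimal m = m_{ij} always satisfies q^m c_j = 1.
-- Since ζ^{M_ii + n/2} = q and ζ^{M_ij} = c_j, the equation q^k c_j = 1 is the congruence
-- n ∣ k (M_ii + n/2) + M_ij. For (2), M only sees the values ψ(e'_j,e'_j) and ψ(e'_j,e'_k) ψ(e'_k,e'_j);
-- expanding them bilinearly for e'_i = -e_i and e'_j = e_j + m_{ij} e_i, every correction factor
-- is a power of some q^{m_{ij}} c_j = 1.

open import Defs
open import Data.Nat as ℕ using (ℕ; zero; suc; _<_; _+_; _*_; _/_; _%_; NonZero)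
open import Data.Nat.Properties using (*-comm; *-suc; +-identityʳ; n≢0⇒n>0; m<1+n⇒m<n∨m≡n)
open import Data.Nat.DivMod using (m≡m%n+[m/n]*n; m%n<n; m/n*n≡m)
open import Data.Nat.Divisibility using (_∣_; divides; _∣?_; m%n≡0⇒n∣m)
open import Data.Integer as ℤ using (ℤ)
import Data.Integer.Properties as ℤ
open import Data.Fin using (Fin; _≟_)
open import Data.Vec using (Vec; []; _∷_)
open import Data.Product using (_×_; ∃; _,_; proj₁; proj₂)
open import Data.Sum using (_⊎_; inj₁; inj₂)
open import Function using (_∘_)
open import Function.Bundles using (_⇔_; mk⇔; Equivalence)
open import Relation.Nullary using (¬_; yes; no; contradiction)
open import Relation.Binary.PropositionalEquality as ≡ using (_≡_; _≢_)
open import Algebra.Bundles using (AbelianGroup)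

Least-⊆ : ∀ {p q} {P : ℕ → Set p} {Q : ℕ → Set q} {m} →
          (∀ {k} → Q k → P k) → Q m → Least P m → Least Q m
Least-⊆ Q⇒P Qm (_ , minimal) = Qm , λ k k<m → minimal k k<m ∘ Q⇒P

Least-cong : ∀ {p q} {P : ℕ → Set p} {Q : ℕ → Set q} →
             (∀ k → P k ⇔ Q k) → ∀ {m} → Least P m ⇔ Least Q m
Least-cong {P = P} {Q} P⇔Q = mk⇔ (λ least → Least-⊆ from (to (proj₁ least)) least)
                                 (λ least → Least-⊆ to (from (proj₁ least)) least)
  where
  to : ∀ {k} → P k → Q k
  to {k} = Equivalence.to (P⇔Q k)
  from : ∀ {k} → Q k → P k
  from {k} = Equivalence.from (P⇔Q k)

half+half : ∀ {n} → 2 ∣ n → n / 2 + n / 2 ≡ n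
half+half {n} 2∣n = ≡.trans (≡.cong (n / 2 +_) (≡.sym (+-identityʳ (n / 2))))
                            (≡.trans (*-comm 2 (n / 2)) (m/n*n≡m 2∣n))

0v+v0v≡0v : ∀ {r} → 0v {r} +v 0v ≡ 0v
0v+v0v≡0v {zero} = ≡.refl
0v+v0v≡0v {suc r} = ≡.cong (ℤ.+ 0 ∷_) 0v+v0v≡0v

+v-inverseˡ : ∀ {r} (a : Vec ℤ r) → negv a +v a ≡ 0v
+v-inverseˡ [] = ≡.refl
+v-inverseˡ (x ∷ a) = ≡.cong₂ _∷_ (ℤ.+-inverseˡ x) (+v-inverseˡ a)

·v-zeroˡ : ∀ {r} (a : Vec ℤ r) → (ℤ.+ 0) ·v a ≡ 0v
·v-zeroˡ [] = ≡.refl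
·v-zeroˡ (x ∷ a) = ≡.cong (ℤ.+ 0 ∷_) (·v-zeroˡ a)

·v-sucˡ : ∀ {r} m (a : Vec ℤ r) → (ℤ.+ suc m) ·v a ≡ a +v ((ℤ.+ m) ·v a)
·v-sucˡ m [] = ≡.refl
·v-sucˡ m (x ∷ a) = ≡.cong₂ _∷_ (ℤ.suc-* (ℤ.+ m) x) (·v-sucˡ m a)

module Powers {c ℓ} (G : AbelianGroup c ℓ) where
  open AbelianGroup G
  open WithGroup G
  open import Algebra.Properties.Monoid.Mult monoid using (×-congʳ; ×-homo-+; ×-assocˡ)
    renaming (_×_ to _×ₙ_)
  open import Algebra.Properties.CommutativeMonoid.Mult commutativeMonoid using (×-distrib-+)
  open import Relation.Binary.Reasoning.Setoid setoid

  pow≡× : ∀ x m → pow x m ≡ m ×ₙ x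
  pow≡× x zero = ≡.refl
  pow≡× x (suc m) = ≡.cong (x ∙_) (pow≡× x m)

  pow-cong : ∀ m {x y} → x ≈ y → pow x m ≈ pow y m
  pow-cong m {x} {y} x≈y rewrite pow≡× x m | pow≡× y m = ×-congʳ m x≈y

  pow-+ : ∀ x m n → pow x (m + n) ≈ pow x m ∙ pow x n
  pow-+ x m n rewrite pow≡× x (m + n) | pow≡× x m | pow≡× x n = ×-homo-+ x m n

  pow-* : ∀ x m n → pow x (m * n) ≈ pow (pow x n) m
  pow-* x m n rewrite pow≡× x (m * n) | pow≡× x n | pow≡× (n ×ₙ x) m = sym (×-assocˡ x m n)

  pow-∙ : ∀ x y m → pow (x ∙ y) m ≈ pow x m ∙ pow y m
  pow-∙ x y m rewrite pow≡× (x ∙ y) m | pow≡× x m | pow≡× y m = ×-distrib-+ x y m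

  pow-ε : ∀ m → pow ε m ≈ ε
  pow-ε zero = refl
  pow-ε (suc m) = trans (identityˡ (pow ε m)) (pow-ε m)

  pow-pow-comm : ∀ x m n → pow (pow x m) n ≈ pow (pow x n) m
  pow-pow-comm x m n = begin
    pow (pow x m) n  ≈⟨ pow-* x n m ⟨
    pow x (n * m)    ≡⟨ ≡.cong (pow x) (*-comm n m) ⟩
    pow x (m * n)    ≈⟨ pow-* x m n ⟩
    pow (pow x n) m  ∎

  pow-period : ∀ {x d} → pow x d ≈ ε → ∀ k → pow x (k * d) ≈ ε
  pow-period {x} {d} xᵈ≈ε k = begin
    pow x (k * d)    ≈⟨ pow-* x k d ⟩
    pow (pow x d) k  ≈⟨ pow-cong k xᵈ≈ε ⟩
    pow ε k          ≈⟨ pow-ε k ⟩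
    ε                ∎

  pow-mod : ∀ {x d} .{{_ : NonZero d}} → pow x d ≈ ε → ∀ m → pow x m ≈ pow x (m % d)
  pow-mod {x} {d} xᵈ≈ε m = begin
    pow x m                            ≡⟨ ≡.cong (pow x) (m≡m%n+[m/n]*n m d) ⟩
    pow x (m % d + m / d * d)          ≈⟨ pow-+ x (m % d) (m / d * d) ⟩
    pow x (m % d) ∙ pow x (m / d * d)  ≈⟨ ∙-congˡ (pow-period xᵈ≈ε (m / d)) ⟩
    pow x (m % d) ∙ ε                  ≈⟨ identityʳ (pow x (m % d)) ⟩
    pow x (m % d)                      ∎

  pow≈ε⇔∣ : ∀ {x n} .{{_ : NonZero n}} → pow x n ≈ ε → (∀ k → 0 < k → k < n → ¬ pow x k ≈ ε) →
            ∀ m → pow x m ≈ ε ⇔ n ∣ m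
  pow≈ε⇔∣ {x} {n} xⁿ≈ε minimal m = mk⇔ to from
    where
    to : pow x m ≈ ε → n ∣ m
    to xᵐ≈ε with n ∣? m
    ... | yes n∣m = n∣m
    ... | no n∤m = contradiction (trans (sym (pow-mod xⁿ≈ε m)) xᵐ≈ε)
                     (minimal (m % n) (n≢0⇒n>0 (n∤m ∘ m%n≡0⇒n∣m m n)) (m%n<n m n))
    from : ∀ {m} → n ∣ m → pow x m ≈ ε
    from (divides k ≡.refl) = pow-period xⁿ≈ε k

  -- When q^{m+1} = 1 and c = q^K, the inverse of c is q^{K m}, whose exponent may be reduced mod m + 1.
  inverse-exponent-below-period : ∀ {q c m} → pow q (suc m) ≈ ε → (∃ λ K → c ≈ pow q K) →
                                  ∃ λ t → t < suc m × pow q t ∙ c ≈ ε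
  inverse-exponent-below-period {q} {c} {m} q¹⁺ᵐ≈ε (K , c≈qᴷ) =
    (K * m) % suc m , m%n<n (K * m) (suc m) , qᵗc≈ε
    where
    qᵗc≈ε : pow q ((K * m) % suc m) ∙ c ≈ ε
    qᵗc≈ε = begin
      pow q ((K * m) % suc m) ∙ c  ≈⟨ ∙-cong (pow-mod q¹⁺ᵐ≈ε (K * m)) (sym c≈qᴷ) ⟨
      pow q (K * m) ∙ pow q K      ≈⟨ comm (pow q (K * m)) (pow q K) ⟩
      pow q K ∙ pow q (K * m)      ≈⟨ pow-+ q K (K * m) ⟨
      pow q (K + K * m)            ≡⟨ ≡.cong (pow q) (*-suc K m) ⟨
      pow q (K * suc m)            ≈⟨ pow-period q¹⁺ᵐ≈ε K ⟩
      ε                            ∎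

  least-exponent-ignores-period : ∀ {q a b m} → (∃ λ K → a ∙ b ≈ pow q K) →
    Least (λ t → pow q (suc t) ≈ ε ⊎ (pow q t ∙ a) ∙ b ≈ ε) m →
    Least (λ t → (pow q t ∙ a) ∙ b ≈ ε) m
  least-exponent-ignores-period {q} {a} {b} {m} ab∈⟨q⟩ least@(found , minimal) =
    Least-⊆ inj₂ (inverse-at-m found) least
    where
    inverse-at-m : pow q (suc m) ≈ ε ⊎ (pow q m ∙ a) ∙ b ≈ ε → (pow q m ∙ a) ∙ b ≈ ε
    inverse-at-m (inj₂ qᵐab≈ε) = qᵐab≈ε
    inverse-at-m (inj₁ q¹⁺ᵐ≈ε) with inverse-exponent-below-period q¹⁺ᵐ≈ε ab∈⟨q⟩
    ... | t , t<1+m , qᵗab≈ε with m<1+n⇒m<n∨m≡n t<1+m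
    ...   | inj₁ t<m = contradiction (inj₂ (trans (assoc _ _ _) qᵗab≈ε)) (minimal t t<m)
    ...   | inj₂ ≡.refl = trans (assoc _ _ _) qᵗab≈ε

  pow-linear≈ε⇔∣ : ∀ {ζ n q a b A B} .{{_ : NonZero n}} →
    pow ζ n ≈ ε → (∀ k → 0 < k → k < n → ¬ pow ζ k ≈ ε) →
    pow ζ A ≈ q → pow ζ B ≈ a ∙ b →
    ∀ k → (pow q k ∙ a) ∙ b ≈ ε ⇔ n ∣ k * A + B
  pow-linear≈ε⇔∣ {ζ} {n} {q} {a} {b} {A} {B} ζⁿ≈ε minimal ζᴬ≈q ζᴮ≈ab k =
    mk⇔ (to ∘ trans (sym exponent)) (trans exponent ∘ from)
    where
    open Equivalence (pow≈ε⇔∣ ζⁿ≈ε minimal (k * A + B))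
    exponent : (pow q k ∙ a) ∙ b ≈ pow ζ (k * A + B)
    exponent = begin
      (pow q k ∙ a) ∙ b          ≈⟨ assoc (pow q k) a b ⟩
      pow q k ∙ (a ∙ b)          ≈⟨ ∙-cong (pow-cong k ζᴬ≈q) ζᴮ≈ab ⟨
      pow (pow ζ A) k ∙ pow ζ B  ≈⟨ ∙-congʳ (pow-* ζ k A) ⟨
      pow ζ (k * A) ∙ pow ζ B    ≈⟨ pow-+ ζ (k * A) B ⟨
      pow ζ (k * A + B)          ∎

module Gram {c ℓ} (G : AbelianGroup c ℓ) {r : ℕ} (ψ : Vec ℤ r → Vec ℤ r → AbelianGroup.Carrier G) where
  open AbelianGroup G
  open WithGroup G
  open Setup ψ
  open Powers G
  open import Relation.Binary.Reasoning.Setoid setoid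

  ψˢ : Vec ℤ r → Vec ℤ r → Carrier
  ψˢ a b = ψ a b ∙ ψ b a

  -- The data from which the matrix M^{ψ,E,ζ} is read off.
  SameGram : (Fin r → Vec ℤ r) → (Fin r → Vec ℤ r) → Set ℓ
  SameGram E₁ E₂ = (∀ j → ψ (E₁ j) (E₁ j) ≈ ψ (E₂ j) (E₂ j))
                 × (∀ j k → j ≢ k → ψˢ (E₁ j) (E₁ k) ≈ ψˢ (E₂ j) (E₂ k))

  SameGram-sym : ∀ {E₁ E₂} → SameGram E₁ E₂ → SameGram E₂ E₁
  SameGram-sym (diagonal , offDiagonal) = sym ∘ diagonal , λ j k j≢k → sym (offDiagonal j k j≢k)

  module _ (ζ : Carrier) (n : ℕ) where
    open WithZeta ζ n

    MProp-⇔ : ∀ {E₁ E₂} → SameGram E₁ E₂ → ∀ j k t → MProp E₁ j k t ⇔ MProp E₂ j k t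
    MProp-⇔ same j k t = mk⇔ (transport same) (transport (SameGram-sym same))
      where
      transport : ∀ {E₁ E₂} → SameGram E₁ E₂ → MProp E₁ j k t → MProp E₂ j k t
      transport (diagonal , offDiagonal) (onDiag , offDiag) =
        (λ j≡k → trans (onDiag j≡k) (∙-congˡ (diagonal j))) ,
        (λ j≢k → trans (offDiag j≢k) (offDiagonal j k j≢k))

    IsM-⇔ : ∀ {E₁ E₂} → SameGram E₁ E₂ → ∀ j k t → IsM E₁ j k t ⇔ IsM E₂ j k t
    IsM-⇔ same j k t = Least-cong (MProp-⇔ same j k)

    neg-involutive : 2 ∣ n → pow ζ n ≈ ε → ∀ x → neg (neg x) ≈ x
    neg-involutive 2∣n ζⁿ≈ε x = begin
      h ∙ (h ∙ x)                ≈⟨ assoc h h x ⟨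
      (h ∙ h) ∙ x                ≈⟨ ∙-congʳ (pow-+ ζ (n / 2) (n / 2)) ⟨
      pow ζ (n / 2 + n / 2) ∙ x  ≡⟨ ≡.cong (λ e → pow ζ e ∙ x) (half+half 2∣n) ⟩
      pow ζ n ∙ x                ≈⟨ ∙-congʳ ζⁿ≈ε ⟩
      ε ∙ x                      ≈⟨ identityˡ x ⟩
      x                          ∎
      where
      h : Carrier
      h = pow ζ (n / 2)

    pow-diagonal-entry : 2 ∣ n → pow ζ n ≈ ε → ∀ E j M → MProp E j j M →
                         pow ζ (M + n / 2) ≈ ψ (E j) (E j)
    pow-diagonal-entry 2∣n ζⁿ≈ε E j M (onDiag , _) = begin
      pow ζ (M + n / 2)            ≈⟨ pow-+ ζ M (n / 2) ⟩
      pow ζ M ∙ pow ζ (n / 2)      ≈⟨ ∙-congʳ (onDiag ≡.refl) ⟩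
      neg q ∙ pow ζ (n / 2)        ≈⟨ comm (neg q) (pow ζ (n / 2)) ⟩
      neg (neg q)                  ≈⟨ neg-involutive 2∣n ζⁿ≈ε q ⟩
      q                            ∎
      where
      q : Carrier
      q = ψ (E j) (E j)

module Bicharacter {c ℓ} (G : AbelianGroup c ℓ) {r : ℕ} (ψ : Vec ℤ r → Vec ℤ r → AbelianGroup.Carrier G)
                   (bic : WithGroup.IsBicharacter G ψ) where
  open AbelianGroup G
  open WithGroup G
  open Setup ψ
  open Powers G
  open Gram G ψ
  open import Algebra.Properties.AbelianGroup G
    using (identityʳ-unique; inverseˡ-unique; inverseʳ-unique; ⁻¹-involutive; ⁻¹-∙-comm)
  open import Algebra.Properties.CommutativeSemigroup commutativeSemigroup using (interchange)
  open import Relation.Binary.Reasoning.Setoid setoid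

  ψ-+ˡ : ∀ a b d → ψ (a +v b) d ≈ ψ a d ∙ ψ b d
  ψ-+ˡ = proj₁ bic

  ψ-+ʳ : ∀ d a b → ψ d (a +v b) ≈ ψ d a ∙ ψ d b
  ψ-+ʳ = proj₂ bic

  ψ-0ˡ : ∀ d → ψ 0v d ≈ ε
  ψ-0ˡ d = identityʳ-unique (ψ 0v d) (ψ 0v d) (begin
    ψ 0v d ∙ ψ 0v d   ≈⟨ ψ-+ˡ 0v 0v d ⟨
    ψ (0v +v 0v) d    ≡⟨ ≡.cong (λ v → ψ v d) 0v+v0v≡0v ⟩
    ψ 0v d            ∎)

  ψ-0ʳ : ∀ d → ψ d 0v ≈ ε
  ψ-0ʳ d = identityʳ-unique (ψ d 0v) (ψ d 0v) (begin
    ψ d 0v ∙ ψ d 0v   ≈⟨ ψ-+ʳ d 0v 0v ⟨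
    ψ d (0v +v 0v)    ≡⟨ ≡.cong (ψ d) 0v+v0v≡0v ⟩
    ψ d 0v            ∎)

  ψ-negˡ : ∀ a d → ψ (negv a) d ≈ ψ a d ⁻¹
  ψ-negˡ a d = inverseˡ-unique (ψ (negv a) d) (ψ a d) (begin
    ψ (negv a) d ∙ ψ a d  ≈⟨ ψ-+ˡ (negv a) a d ⟨
    ψ (negv a +v a) d     ≡⟨ ≡.cong (λ v → ψ v d) (+v-inverseˡ a) ⟩
    ψ 0v d                ≈⟨ ψ-0ˡ d ⟩
    ε                     ∎)

  ψ-negʳ : ∀ d a → ψ d (negv a) ≈ ψ d a ⁻¹
  ψ-negʳ d a = inverseˡ-unique (ψ d (negv a)) (ψ d a) (begin
    ψ d (negv a) ∙ ψ d a  ≈⟨ ψ-+ʳ d (negv a) a ⟨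
    ψ d (negv a +v a)     ≡⟨ ≡.cong (ψ d) (+v-inverseˡ a) ⟩
    ψ d 0v                ≈⟨ ψ-0ʳ d ⟩
    ε                     ∎)

  ψ-·ˡ : ∀ m a d → ψ ((ℤ.+ m) ·v a) d ≈ pow (ψ a d) m
  ψ-·ˡ zero a d = trans (reflexive (≡.cong (λ v → ψ v d) (·v-zeroˡ a))) (ψ-0ˡ d)
  ψ-·ˡ (suc m) a d = begin
    ψ ((ℤ.+ suc m) ·v a) d             ≡⟨ ≡.cong (λ v → ψ v d) (·v-sucˡ m a) ⟩
    ψ (a +v ((ℤ.+ m) ·v a)) d          ≈⟨ ψ-+ˡ a ((ℤ.+ m) ·v a) d ⟩
    ψ a d ∙ ψ ((ℤ.+ m) ·v a) d         ≈⟨ ∙-congˡ (ψ-·ˡ m a d) ⟩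
    ψ a d ∙ pow (ψ a d) m              ∎

  ψ-·ʳ : ∀ m d a → ψ d ((ℤ.+ m) ·v a) ≈ pow (ψ d a) m
  ψ-·ʳ zero d a = trans (reflexive (≡.cong (ψ d) (·v-zeroˡ a))) (ψ-0ʳ d)
  ψ-·ʳ (suc m) d a = begin
    ψ d ((ℤ.+ suc m) ·v a)             ≡⟨ ≡.cong (ψ d) (·v-sucˡ m a) ⟩
    ψ d (a +v ((ℤ.+ m) ·v a))          ≈⟨ ψ-+ʳ d a ((ℤ.+ m) ·v a) ⟩
    ψ d a ∙ ψ d ((ℤ.+ m) ·v a)         ≈⟨ ∙-congˡ (ψ-·ʳ m d a) ⟩
    ψ d a ∙ pow (ψ d a) m              ∎

  ψ-transvectˡ : ∀ y m x w → ψ (y +v ((ℤ.+ m) ·v x)) w ≈ ψ y w ∙ pow (ψ x w) m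
  ψ-transvectˡ y m x w = trans (ψ-+ˡ y _ w) (∙-congˡ (ψ-·ˡ m x w))

  ψ-transvectʳ : ∀ w y m x → ψ w (y +v ((ℤ.+ m) ·v x)) ≈ ψ w y ∙ pow (ψ w x) m
  ψ-transvectʳ w y m x = trans (ψ-+ʳ w y _) (∙-congˡ (ψ-·ʳ m w x))

  ψˢ-comm : ∀ a b → ψˢ a b ≈ ψˢ b a
  ψˢ-comm a b = comm (ψ a b) (ψ b a)

  ψˢ-negˡ : ∀ x w → ψˢ (negv x) w ≈ ψˢ x w ⁻¹
  ψˢ-negˡ x w = trans (∙-cong (ψ-negˡ x w) (ψ-negʳ w x)) (⁻¹-∙-comm (ψ x w) (ψ w x))

  ψˢ-transvectʳ : ∀ w y m x → ψˢ w (y +v ((ℤ.+ m) ·v x)) ≈ ψˢ w y ∙ pow (ψˢ w x) m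
  ψˢ-transvectʳ w y m x = begin
    ψ w u ∙ ψ u w                                        ≈⟨ ∙-cong (ψ-transvectʳ w y m x) (ψ-transvectˡ y m x w) ⟩
    (ψ w y ∙ pow (ψ w x) m) ∙ (ψ y w ∙ pow (ψ x w) m)    ≈⟨ interchange (ψ w y) _ (ψ y w) _ ⟩
    ψˢ w y ∙ (pow (ψ w x) m ∙ pow (ψ x w) m)             ≈⟨ ∙-congˡ (pow-∙ (ψ w x) (ψ x w) m) ⟨
    ψˢ w y ∙ pow (ψˢ w x) m                              ∎
    where
    u : Vec ℤ r
    u = y +v ((ℤ.+ m) ·v x)

  ψˢ-transvectˡ : ∀ y m x w → ψˢ (y +v ((ℤ.+ m) ·v x)) w ≈ ψˢ y w ∙ pow (ψˢ x w) m
  ψˢ-transvectˡ y m x w = begin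
    ψˢ (y +v ((ℤ.+ m) ·v x)) w  ≈⟨ ψˢ-comm _ w ⟩
    ψˢ w (y +v ((ℤ.+ m) ·v x))  ≈⟨ ψˢ-transvectʳ w y m x ⟩
    ψˢ w y ∙ pow (ψˢ w x) m     ≈⟨ ∙-cong (ψˢ-comm w y) (pow-cong m (ψˢ-comm w x)) ⟩
    ψˢ y w ∙ pow (ψˢ x w) m     ∎

  module Transvection (x y : Vec ℤ r) (m : ℕ) (qᵐψˢ≈ε : pow (ψ x x) m ∙ ψˢ x y ≈ ε) where
    q : Carrier
    q = ψ x x

    u : Vec ℤ r
    u = y +v ((ℤ.+ m) ·v x)

    ψ-transvect-diagonal : ψ u u ≈ ψ y y
    ψ-transvect-diagonal = begin
      ψ u u                                                ≈⟨ ψ-transvectˡ y m x u ⟩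
      ψ y u ∙ pow (ψ x u) m                                ≈⟨ ∙-cong (ψ-transvectʳ y y m x)
                                                                     (pow-cong m (ψ-transvectʳ x y m x)) ⟩
      (ψ y y ∙ pow (ψ y x) m) ∙ pow (ψ x y ∙ pow q m) m    ≈⟨ assoc (ψ y y) _ _ ⟩
      ψ y y ∙ (pow (ψ y x) m ∙ pow (ψ x y ∙ pow q m) m)    ≈⟨ ∙-congˡ (pow-∙ (ψ y x) _ m) ⟨
      ψ y y ∙ pow (ψ y x ∙ (ψ x y ∙ pow q m)) m            ≈⟨ ∙-congˡ (pow-cong m (trans reorder qᵐψˢ≈ε)) ⟩
      ψ y y ∙ pow ε m                                      ≈⟨ ∙-congˡ (pow-ε m) ⟩
      ψ y y ∙ ε                                            ≈⟨ identityʳ (ψ y y) ⟩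
      ψ y y                                                ∎
      where
      reorder : ψ y x ∙ (ψ x y ∙ pow q m) ≈ pow q m ∙ ψˢ x y
      reorder = begin
        ψ y x ∙ (ψ x y ∙ pow q m)  ≈⟨ comm (ψ y x) _ ⟩
        (ψ x y ∙ pow q m) ∙ ψ y x  ≈⟨ ∙-congʳ (comm (ψ x y) (pow q m)) ⟩
        (pow q m ∙ ψ x y) ∙ ψ y x  ≈⟨ assoc (pow q m) (ψ x y) (ψ y x) ⟩
        pow q m ∙ ψˢ x y           ∎

    ψˢ-self-transvect : ψˢ x u ≈ pow q m
    ψˢ-self-transvect = begin
      ψˢ x u                            ≈⟨ ψˢ-transvectʳ x y m x ⟩
      ψˢ x y ∙ pow (q ∙ q) m            ≈⟨ ∙-congˡ (pow-∙ q q m) ⟩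
      ψˢ x y ∙ (pow q m ∙ pow q m)      ≈⟨ assoc (ψˢ x y) (pow q m) (pow q m) ⟨
      (ψˢ x y ∙ pow q m) ∙ pow q m      ≈⟨ ∙-congʳ (trans (comm (ψˢ x y) (pow q m)) qᵐψˢ≈ε) ⟩
      ε ∙ pow q m                       ≈⟨ identityˡ (pow q m) ⟩
      pow q m                           ∎

    ψˢ-reflect-transvect : ψˢ (negv x) u ≈ ψˢ x y
    ψˢ-reflect-transvect = begin
      ψˢ (negv x) u  ≈⟨ ψˢ-negˡ x u ⟩
      ψˢ x u ⁻¹      ≈⟨ ⁻¹-cong ψˢ-self-transvect ⟩
      pow q m ⁻¹     ≈⟨ inverseʳ-unique (pow q m) (ψˢ x y) qᵐψˢ≈ε ⟨
      ψˢ x y         ∎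

  ψ-reflect-diagonal : ∀ x → ψ (negv x) (negv x) ≈ ψ x x
  ψ-reflect-diagonal x = begin
    ψ (negv x) (negv x)  ≈⟨ ψ-negˡ x (negv x) ⟩
    ψ x (negv x) ⁻¹      ≈⟨ ⁻¹-cong (ψ-negʳ x x) ⟩
    ψ x x ⁻¹ ⁻¹          ≈⟨ ⁻¹-involutive (ψ x x) ⟩
    ψ x x                ∎

  ψˢ-transvect-transvect : ∀ x y z m m′ → pow (ψ x x) m ∙ ψˢ x y ≈ ε → pow (ψ x x) m′ ∙ ψˢ x z ≈ ε →
                           ψˢ (y +v ((ℤ.+ m) ·v x)) (z +v ((ℤ.+ m′) ·v x)) ≈ ψˢ y z
  ψˢ-transvect-transvect x y z m m′ kills-y kills-z = begin
    ψˢ u v                                          ≈⟨ ψˢ-transvectʳ u z m′ x ⟩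
    ψˢ u z ∙ pow (ψˢ u x) m′                        ≈⟨ ∙-cong (ψˢ-transvectˡ y m x z) (pow-cong m′ ψˢux≈qᵐ) ⟩
    (ψˢ y z ∙ pow (ψˢ x z) m) ∙ pow (pow q m) m′    ≈⟨ assoc (ψˢ y z) _ _ ⟩
    ψˢ y z ∙ (pow (ψˢ x z) m ∙ pow (pow q m) m′)    ≈⟨ ∙-congˡ (∙-congˡ (pow-pow-comm q m m′)) ⟩
    ψˢ y z ∙ (pow (ψˢ x z) m ∙ pow (pow q m′) m)    ≈⟨ ∙-congˡ (pow-∙ (ψˢ x z) (pow q m′) m) ⟨
    ψˢ y z ∙ pow (ψˢ x z ∙ pow q m′) m              ≈⟨ ∙-congˡ (pow-cong m (trans (comm _ _) kills-z)) ⟩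
    ψˢ y z ∙ pow ε m                                ≈⟨ ∙-congˡ (pow-ε m) ⟩
    ψˢ y z ∙ ε                                      ≈⟨ identityʳ (ψˢ y z) ⟩
    ψˢ y z                                          ∎
    where
    q : Carrier
    q = ψ x x
    u v : Vec ℤ r
    u = y +v ((ℤ.+ m) ·v x)
    v = z +v ((ℤ.+ m′) ·v x)
    ψˢux≈qᵐ : ψˢ u x ≈ pow q m
    ψˢux≈qᵐ = trans (ψˢ-comm u x) (Transvection.ψˢ-self-transvect x y m kills-y)

  module Reflection (E : Fin r → Vec ℤ r) (i : Fin r) (mij : Fin r → ℕ) where
    E′ : Fin r → Vec ℤ r
    E′ = sRefl E i mij

    sRefl-SameGram : (∀ j → j ≢ i → pow (ψ (E i) (E i)) (mij j) ∙ ψˢ (E i) (E j) ≈ ε) → SameGram E′ E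
    sRefl-SameGram kills = diagonal , offDiagonal
      where
      diagonal : ∀ j → ψ (E′ j) (E′ j) ≈ ψ (E j) (E j)
      -- Abstracting over j ≟ i also unfolds E′ j = sRefl E i mij j.
      diagonal j with j ≟ i
      ... | yes ≡.refl = ψ-reflect-diagonal (E i)
      ... | no j≢i = Transvection.ψ-transvect-diagonal (E i) (E j) (mij j) (kills j j≢i)

      offDiagonal : ∀ j k → j ≢ k → ψˢ (E′ j) (E′ k) ≈ ψˢ (E j) (E k)
      offDiagonal j k j≢k with j ≟ i | k ≟ i
      ... | yes ≡.refl | yes ≡.refl = contradiction ≡.refl j≢k
      ... | yes ≡.refl | no k≢i =
        Transvection.ψˢ-reflect-transvect (E i) (E k) (mij k) (kills k k≢i)
      ... | no j≢i | yes ≡.refl =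
        trans (ψˢ-comm _ _)
              (trans (Transvection.ψˢ-reflect-transvect (E i) (E j) (mij j) (kills j j≢i)) (ψˢ-comm _ _))
      ... | no j≢i | no k≢i =
        ψˢ-transvect-transvect (E i) (E j) (E k) (mij j) (mij k) (kills j j≢i) (kills k k≢i)

lemma5p16 : ∀ {c ℓ} (G : AbelianGroup c ℓ) (r : ℕ)
  (ψ : Vec ℤ r → Vec ℤ r → AbelianGroup.Carrier G)
  (E : Fin r → Vec ℤ r) (ζ : AbelianGroup.Carrier G) (n : ℕ) (i : Fin r)
  (mij : Fin r → ℕ) →
  let open AbelianGroup G
      open WithGroup G
      open Setup ψ
      open WithZeta ζ n
  in IsBicharacter ψ →
     IsBasis E →
     0 < n →
     2 ∣ n →
     pow ζ n ≈ ε →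
     (∀ k → 0 < k → k < n → ¬ (pow ζ k ≈ ε)) →
     (∀ a b → ∃ λ k → ψ a b ≈ pow ζ k) →
     Admissible E i →
     (∀ a → ∃ λ k → ψ (E i) a ∙ ψ a (E i) ≈ pow (ψ (E i) (E i)) k) →
     (∀ j → j ≢ i → IsMij E i j (mij j)) →
     (∀ j → j ≢ i →
        Least (λ m → (pow (ψ (E i) (E i)) m ∙ ψ (E i) (E j)) ∙ ψ (E j) (E i) ≈ ε) (mij j)
        × (∀ Mii Mij → IsM E i i Mii → IsM E i j Mij →
             Least (λ k → n ∣ k * (Mii + n / 2) + Mij) (mij j)))
     × (∀ j k m → IsM (sRefl E i mij) j k m ⇔ IsM E j k m)

-- The numbers m_{ij} and the entries of M are supplied with their defining properties, so the
-- basis property, the ζ-valuedness of ψ and the admissibility of E at i are not needed.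
lemma5p16 G r ψ E ζ n i mij bic _ 0<n 2∣n ζⁿ≈ε ζ-minimal _ _ ψˢ-power-of-q isMij =
  (λ j j≢i → least-inverse j j≢i , least-divisible j j≢i) ,
  IsM-⇔ ζ n (sRefl-SameGram (λ j j≢i → trans (sym (assoc _ _ _)) (proj₁ (least-inverse j j≢i))))
  where
  open AbelianGroup G
  open WithGroup G
  open Setup ψ
  open Powers G
  open Gram G ψ
  open Bicharacter G ψ bic
  open Reflection E i mij
  open WithZeta ζ n

  instance
    _ : NonZero n
    _ = ℕ.>-nonZero 0<n

  q : Carrier
  q = ψ (E i) (E i)

  least-inverse : ∀ j → j ≢ i → Least (λ m → (pow q m ∙ ψ (E i) (E j)) ∙ ψ (E j) (E i) ≈ ε) (mij j)
  least-inverse j j≢i = least-exponent-ignores-period (ψˢ-power-of-q (E j)) (isMij j j≢i)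

  least-divisible : ∀ j → j ≢ i → ∀ Mii Mij → IsM E i i Mii → IsM E i j Mij →
                    Least (λ k → n ∣ k * (Mii + n / 2) + Mij) (mij j)
  least-divisible j j≢i Mii Mij (Mii-spec , _) ((_ , offDiag) , _) =
    Equivalence.to (Least-cong (pow-linear≈ε⇔∣ ζⁿ≈ε ζ-minimal ζᴬ≈q (offDiag (j≢i ∘ ≡.sym))))
                   (least-inverse j j≢i)
    where
    ζᴬ≈q : pow ζ (Mii + n / 2) ≈ q
    ζᴬ≈q = pow-diagonal-entry ζ n 2∣n ζⁿ≈ε E i Mii Mii-spec
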